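{- If the sentence $\varphi$ (as in the context) belongs to GAF, then for every $x\in\vec{x}$: (i) $\mathcal{L}_{x,k}\subseteq\mathcal{L}_x$ for every $k\in\{0,\mathrm{idx}(x),\ldots,n\}$; (ii) $\mathcal{L}_{x,k}\cap\mathcal{L}_{x,\ell}=\emptyset$ for all distinct such $k,\ell$; (iii) for every $k>0$ (with $\mathrm{idx}(x)\le k\le n$), $\mathrm{vars}(\mathcal{L}_{x,k})\cap\vec{y}\subseteq\bigcup_{i\le k}\vec{y}_i$; (iv) $\mathrm{vars}(\mathcal{L}_{x,0})\cap\vec{y}\subseteq\bigcup_{i<\mathrm{idx}(x)}\vec{y}_i$.
   Context: Let $\varphi := \forall \vec{x}_1 \exists \vec{y}_1 \ldots \forall \vec{x}_n \exists \vec{y}_n.\,\psi$ be a sentence in standard form ($\vec{x}_i,\vec{y}_i$ tuples of variables, $\vec{x}_1$, $\vec{y}_n$ possibly empty; $\psi$ quantifier-free, in negation normal form, using only $\wedge,\vee,\neg$; every prefix variable occurs in $\psi$; no variable bound twice) without equality and without non-constant function symbols. Let $\vec{x}:=\bigcup_i\vec{x}_i$, $\vec{y}:=\bigcup_i\vec{y}_i$, $\mathrm{At}$ the set of atoms, $\mathrm{vars}(S)$ the set of variables in a set $S$ of atoms or literals, and $\mathrm{idx}(v):=k$ iff $v\in\vec{x}_k$ or $v\in\vec{y}_k$. $\varphi$ belongs to GAF iff $\mathrm{At}$ can be partitioned into sets $\mathrm{At}_0$ and $\mathrm{At}_x$, $x\in\vec{x}$, such that (a) $\mathrm{vars}(\mathrm{At}_0)\cap\vec{x}=\emptyset$;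 (b) $\mathrm{vars}(\mathrm{At}_x)\cap\vec{x}=\{x\}$ for every $x$; (c) for every $y\in\vec{y}$ occurring in some $\mathrm{At}_x$, exactly one of: (c.1) for every $\mathrm{At}_x$ containing $y$, $\mathrm{idx}(y)<\mathrm{idx}(x)$; or (c.2) $y$ occurs in exactly one $\mathrm{At}_x$, not in $\mathrm{At}_0$, and $\mathrm{idx}(y)\ge\mathrm{idx}(x)$. Let $\mathcal{G}_\varphi$ be the directed graph on $\vec{y}$ with an edge $\langle y,y'\rangle$ iff $\mathrm{idx}(y)\le\mathrm{idx}(y')$ and some atom of $\psi$ contains both. The upward closure $\Cup_y$ is the smallest subset of $\vec{y}$ containing $y$ and closed under edges; $\mathcal{L}(\Cup_y)$ is the set of literals of $\psi$ containing a variable from $\Cup_y$. For $x\in\vec{x}$, $\mathcal{L}_x$ is the smallest set of literals containing every literal of $\psi$ in which $x$ occurs and such that $\mathcal{L}(\Cup_y)\subseteq\mathcal{L}_x$ for every $y\in\mathrm{vars}(\mathcal{L}_x)\cap\vec{y}$ with $\mathrm{idx}(y)\ge\mathrm{idx}(x)$. Define $\mathcal{L}_{x,n}:=\bigcup_{y\in\mathrm{vars}(\mathcal{L}_x)\cap\vec{y}_n}\mathcal{L}(\Cup_y)$; for $\mathrm{idx}(x)\le k<n$, $\mathcal{L}_{x,k}:=\bigcup_{y\in\mathrm{vars}(\mathcal{L}_x)\cap\vec{y}_k}\mathcal{L}(\Cup_y)\setminus\bigcup_{\ell>k}\mathcal{L}_{x,\ell}$; and $\mathcal{L}_{x,0}:=\mathcal{L}_x\setminus\bigcup_{\ell\ge\mathrm{idx}(x)}\mathcal{L}_{x,\ell}$.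 -}

module Defs where

open import Data.Nat using (ℕ; zero; suc; _≤_; _<_; _∸_)
open import Data.List using (List; map)
open import Data.List.Membership.Propositional using (_∈_)
open import Data.List.Relation.Unary.Unique.Propositional using (Unique)
open import Data.Product using (Σ; ∃; ∃₂; _×_; _,_; proj₁)
open import Data.Sum using (_⊎_)
open import Data.Maybe using (Maybe; just; nothing)
open import Relation.Binary.PropositionalEquality using (_≡_)
open import Relation.Nullary using (¬_)

Var : Set
Var = ℕ

data Term : Set where
  var   : Var → Term
  const : ℕ → Term

record Atom : Set where
  constructor _⦅_⦆
  field
    pred : ℕ
    args : List Term

data Literal : Set where
  pos : Atom → Literal
  neg : Atom → Literal

atomOf : Literal → Atom
atomOf (pos A) = A
atomOf (neg A) = A

data Formula : Set where
  lit  : Literal → Formula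
  _∧ᶠ_ : Formula → Formula → Formula
  _∨ᶠ_ : Formula → Formula → Formula

data Quant : Set where
  ∀q : Quant
  ∃q : Quant

-- A sentence ∀x⃗₁∃y⃗₁…∀x⃗ₙ∃y⃗ₙ.ψ : the prefix lists every bound variable
-- together with its quantifier and its block index (idx).
record Sentence : Set where
  field
    n      : ℕ
    prefix : List (Var × Quant × ℕ)
    ψ      : Formula

module Notions (φ : Sentence) where
  open Sentence φ public

  _inA_ : Var → Atom → Set
  v inA A = var v ∈ Atom.args A

  _inL_ : Var → Literal → Set
  v inL l = v inA atomOf l

  data LitIn (l : Literal) : Formula → Set where
    here : LitIn l (lit l)
    ∧ˡ   : ∀ {F G} → LitIn l F → LitIn l (F ∧ᶠ G)
    ∧ʳ   : ∀ {F G} → LitIn l G → LitIn l (F ∧ᶠ G)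
    ∨ˡ   : ∀ {F G} → LitIn l F → LitIn l (F ∨ᶠ G)
    ∨ʳ   : ∀ {F G} → LitIn l G → LitIn l (F ∨ᶠ G)

  Lit : Literal → Set
  Lit l = LitIn l ψ

  At : Atom → Set
  At A = ∃ λ l → Lit l × atomOf l ≡ A

  VarInψ : Var → Set
  VarInψ v = ∃ λ l → Lit l × v inL l

  IsX : Var → ℕ → Set
  IsX v i = (v , ∀q , i) ∈ prefix

  IsY : Var → ℕ → Set
  IsY v i = (v , ∃q , i) ∈ prefix

  record StandardForm : Set where
    field
      blockRange : ∀ {v q i} → (v , q , i) ∈ prefix → 1 ≤ i × i ≤ n
      noRebind   : Unique (map proj₁ prefix)
      prefixOcc  : ∀ {v q i} → (v , q , i) ∈ prefix → VarInψ v
      closed     : ∀ v → VarInψ v → ∃₂ λ q i → (v , q , i) ∈ prefix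
      xNonEmpty  : ∀ i → 2 ≤ i → i ≤ n → ∃ λ v → IsX v i
      yNonEmpty  : ∀ i → 1 ≤ i → i < n → ∃ λ v → IsY v i

  -- GAF.  The partition of At into At₀ and At_x (x ∈ x⃗) is given by an
  -- assignment  part : Atom → Maybe Var  (nothing ↦ At₀, just x ↦ At_x),
  -- relevant on the atoms of ψ.

  module Partition (part : Atom → Maybe Var) where
    At₀ : Atom → Set
    At₀ A = At A × part A ≡ nothing

    AtX : Var → Atom → Set
    AtX x A = At A × part A ≡ just x

    _inAtX_ : Var → Var → Set
    y inAtX x = ∃ λ A → AtX x A × y inA A

    C1 : Var → ℕ → Set
    C1 y j = ∀ x i → IsX x i → y inAtX x → j < i

    C2 : Var → ℕ → Set
    C2 y j = ∃ λ x → y inAtX x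
                 × (∀ x' → y inAtX x' → x' ≡ x)
                 × ¬ (∃ λ A → At₀ A × y inA A)
                 × (∀ i → IsX x i → i ≤ j)

    record IsGAFPartition : Set where
      field
        blocksIndexed : ∀ z A → AtX z A → ∃ λ i → IsX z i
        condA : ∀ A → At₀ A → ∀ v i → IsX v i → ¬ (v inA A)
        condB₁ : ∀ x i → IsX x i → x inAtX x
        condB₂ : ∀ x A v i → AtX x A → IsX v i → v inA A → v ≡ x
        condC : ∀ y j → IsY y j → (∃ λ x → y inAtX x)
                → (C1 y j ⊎ C2 y j) × ¬ (C1 y j × C2 y j)

  GAF : Set
  GAF = Σ (Atom → Maybe Var) λ part → Partition.IsGAFPartition part

  Edge : Var → Var → Set
  Edge y y' = ∃₂ λ i j → IsY y i × IsY y' j × i ≤ j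
              × ∃ λ A → At A × y inA A × y' inA A

  data Cup (y : Var) : Var → Set where
    self : Cup y y
    step : ∀ {z z'} → Cup y z → Edge z z' → Cup y z'

  LCup : Var → Literal → Set
  LCup y l = Lit l × ∃ λ z → Cup y z × z inL l

  module _ (x : Var) (ix : ℕ) where

    data Lx : Literal → Set where
      base  : ∀ {l} → Lit l → x inL l → Lx l
      close : ∀ {l l' y j} → Lx l' → y inL l' → IsY y j → ix ≤ j
              → LCup y l → Lx l

    U : ℕ → Literal → Set
    U k l = ∃ λ y → IsY y k × (∃ λ l' → Lx l' × y inL l') × LCup y l

    -- Lnd d = 𝓛_{x, n ∸ d} ;  Above d = ⋃_{j ≤ d} 𝓛_{x, n ∸ j}
    --       = ⋃_{n ∸ d ≤ ℓ ≤ n} 𝓛_{x,ℓ}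
    mutual
      Lnd : ℕ → Literal → Set
      Lnd zero    l = U n l
      Lnd (suc d) l = U (n ∸ suc d) l × ¬ Above d l

      Above : ℕ → Literal → Set
      Above zero    l = Lnd zero l
      Above (suc d) l = Lnd (suc d) l ⊎ Above d l

    Lhigh : ℕ → Literal → Set
    Lhigh k = Lnd (n ∸ k)

    L0 : Literal → Set
    L0 l = Lx l × ¬ (∃ λ k → ix ≤ k × k ≤ n × Lhigh k l)

    Lk : ℕ → Literal → Set
    Lk zero    = L0
    Lk (suc k) = Lhigh (suc k)

    ValidK : ℕ → Set
    ValidK k = k ≡ 0 ⊎ (ix ≤ k × k ≤ n)

-- 𝓛_{x,n}, 𝓛_{x,n-1}, … are carved out of the sets U_k := ⋃_{y ∈ vars(𝓛_x) ∩ y⃗_k} 𝓛(⋓_y)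
-- by removing at each step everything already taken, so they are pairwise disjoint and
-- each lies in some U_k ⊆ 𝓛_x. A literal of 𝓛_x containing y ∈ y⃗_j lies in U_j, so it
-- cannot be left over for any 𝓛_{x,k} with k < j, nor for 𝓛_{x,0} when j ≥ idx(x).
module Submission where

open import Defs
open import Data.Nat using (ℕ; zero; suc; _≤_; _<_; _∸_; s≤s)
open import Data.Nat.Properties
  using (≤-refl; ≤-trans; <⇒≢; m≤n⇒m<n∨m≡n; m≤n⇒m≤1+n; ≮⇒≥; ≰⇒>;
         ∸-monoʳ-≤; m∸n≤m; m∸[m∸n]≡n; ∸-cancelˡ-≡; <-cmp)
open import Data.Product using (∃; _×_; _,_; proj₂)
open import Data.Sum using (inj₁; inj₂)
open import Data.Empty using (⊥)
open import Relation.Binary.PropositionalEquality using (_≢_; refl; sym; subst)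
open import Relation.Nullary using (¬_)
open import Relation.Binary.Definitions using (tri<; tri≈; tri>)
open import Function using (_∘_)

module Layers (φ : Sentence) (x : Var) (ix : ℕ) where
  open Notions φ

  Lx⇒Lit : ∀ {l} → Lx x ix l → Lit l
  Lx⇒Lit (base l∈ψ _)             = l∈ψ
  Lx⇒Lit (close _ _ _ _ (l∈ψ , _)) = l∈ψ

  U⇒Lx : ∀ {k l} → ix ≤ k → U x ix k l → Lx x ix l
  U⇒Lx ix≤k (y , y∈k , (l' , l'∈Lx , y∈l') , l∈⋓y) = close l'∈Lx y∈l' y∈k ix≤k l∈⋓y

  Lx-occurrence⇒U : ∀ {l y j} → Lx x ix l → y inL l → IsY y j → U x ix j l
  Lx-occurrence⇒U {l} {y} l∈Lx y∈l y∈j =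
    y , y∈j , (l , l∈Lx , y∈l) , (Lx⇒Lit l∈Lx , y , self , y∈l)

  Lnd⇒U : ∀ d {l} → Lnd x ix d l → U x ix (n ∸ d) l
  Lnd⇒U zero    u       = u
  Lnd⇒U (suc d) (u , _) = u

  Lnd⇒Above : ∀ {d e l} → e ≤ d → Lnd x ix e l → Above x ix d l
  Lnd⇒Above {zero}  {zero} _   p = p
  Lnd⇒Above {suc d}        e≤d p with m≤n⇒m<n∨m≡n e≤d
  ... | inj₁ (s≤s e≤d) = inj₂ (Lnd⇒Above e≤d p)
  ... | inj₂ refl      = inj₁ p

  Above⇒Lnd : ∀ d {l} → Above x ix d l → ∃ λ e → e ≤ d × Lnd x ix e l
  Above⇒Lnd zero    p        = zero , ≤-refl , p
  Above⇒Lnd (suc d) (inj₁ p) = suc d , ≤-refl , p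
  Above⇒Lnd (suc d) (inj₂ p) with Above⇒Lnd d p
  ... | e , e≤d , q = e , m≤n⇒m≤1+n e≤d , q

  Lnd-disjoint-< : ∀ {d d' l} → d < d' → Lnd x ix d l → Lnd x ix d' l → ⊥
  Lnd-disjoint-< {d' = suc d'} (s≤s d≤d') p (_ , ¬above) = ¬above (Lnd⇒Above d≤d' p)

  Lnd-disjoint : ∀ {d d' l} → d ≢ d' → Lnd x ix d l → Lnd x ix d' l → ⊥
  Lnd-disjoint {d} {d'} d≢d' p q with <-cmp d d'
  ... | tri< d<d' _ _ = Lnd-disjoint-< d<d' p q
  ... | tri≈ _ d≡d' _ = d≢d' d≡d'
  ... | tri> _ _ d'<d = Lnd-disjoint-< d'<d q p

  -- Membership in Above is only established up to ¬¬, as each layer is defined by a negation.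
  U⇒¬¬Above-exact : ∀ d {l} → U x ix (n ∸ d) l → ¬ ¬ Above x ix d l
  U⇒¬¬Above-exact zero    u ¬above = ¬above u
  U⇒¬¬Above-exact (suc d) u ¬above = ¬above (inj₁ (u , ¬above ∘ inj₂))

  U⇒¬¬Above : ∀ {d m l} → m ≤ n → n ∸ m ≤ d → U x ix m l → ¬ ¬ Above x ix d l
  U⇒¬¬Above {d} {m} m≤n n∸m≤d u with m≤n⇒m<n∨m≡n n∸m≤d
  ... | inj₂ refl =
    U⇒¬¬Above-exact (n ∸ m) (subst (λ k → U x ix k _) (sym (m∸[m∸n]≡n m≤n)) u)
  U⇒¬¬Above {suc d} m≤n _ u | inj₁ (s≤s n∸m≤d) =
    λ ¬above → U⇒¬¬Above m≤n n∸m≤d u (¬above ∘ inj₂)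

  Lhigh⇒U : ∀ {k l} → k ≤ n → Lhigh x ix k l → U x ix k l
  Lhigh⇒U {k} {l} k≤n p = subst (λ m → U x ix m l) (m∸[m∸n]≡n k≤n) (Lnd⇒U (n ∸ k) p)

  Lhigh-disjoint : ∀ {k k' l} → k ≤ n → k' ≤ n → k ≢ k' →
                   Lhigh x ix k l → Lhigh x ix k' l → ⊥
  Lhigh-disjoint k≤n k'≤n k≢k' = Lnd-disjoint (k≢k' ∘ ∸-cancelˡ-≡ k≤n k'≤n)

  U⇒¬¬Lhigh : ∀ {k m l} → k ≤ m → m ≤ n → U x ix m l →
              ¬ ¬ (∃ λ k' → k ≤ k' × k' ≤ n × Lhigh x ix k' l)
  U⇒¬¬Lhigh {k} {m} {l} k≤m m≤n u ¬lhigh =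
    U⇒¬¬Above m≤n (∸-monoʳ-≤ n k≤m) u (¬lhigh ∘ reindex)
    where
    k≤n : k ≤ n
    k≤n = ≤-trans k≤m m≤n

    reindex : Above x ix (n ∸ k) l → ∃ λ k' → k ≤ k' × k' ≤ n × Lhigh x ix k' l
    reindex above with Above⇒Lnd (n ∸ k) above
    ... | e , e≤n∸k , p =
      n ∸ e ,
      subst (_≤ n ∸ e) (m∸[m∸n]≡n k≤n) (∸-monoʳ-≤ n e≤n∸k) ,
      m∸n≤m n e ,
      subst (λ d → Lnd x ix d l) (sym (m∸[m∸n]≡n (≤-trans e≤n∸k (m∸n≤m n k)))) p

  ValidK-suc : ∀ {k} → ValidK x ix (suc k) → ix ≤ suc k × suc k ≤ n
  ValidK-suc (inj₂ bounds) = bounds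

  Lk⊆Lx : ∀ k → ValidK x ix k → ∀ l → Lk x ix k l → Lx x ix l
  Lk⊆Lx zero    _     _ (l∈Lx , _) = l∈Lx
  Lk⊆Lx (suc k) valid _ p          =
    let ix≤k , k≤n = ValidK-suc valid in U⇒Lx ix≤k (Lhigh⇒U k≤n p)

  Lk-disjoint : ∀ k ℓ → ValidK x ix k → ValidK x ix ℓ → k ≢ ℓ →
                ∀ l → Lk x ix k l → Lk x ix ℓ l → ⊥
  Lk-disjoint zero    zero    _      _      k≢ℓ _ _            _ = k≢ℓ refl
  Lk-disjoint zero    (suc ℓ) _      validℓ _   _ (_ , ¬high) q =
    let ix≤ℓ , ℓ≤n = ValidK-suc validℓ in ¬high (suc ℓ , ix≤ℓ , ℓ≤n , q)
  Lk-disjoint (suc k) zero    validk _      _   _ p (_ , ¬high) =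
    let ix≤k , k≤n = ValidK-suc validk in ¬high (suc k , ix≤k , k≤n , p)
  Lk-disjoint (suc k) (suc ℓ) validk validℓ k≢ℓ _ p q =
    Lhigh-disjoint (proj₂ (ValidK-suc validk)) (proj₂ (ValidK-suc validℓ)) k≢ℓ p q

  module _ (block≤n : ∀ {y j} → IsY y j → j ≤ n) where

    Lk-vars : ∀ k → ValidK x ix k → 0 < k →
              ∀ y j → IsY y j → (∃ λ l → Lk x ix k l × y inL l) → j ≤ k
    Lk-vars (suc k) valid _ y j y∈j (l , p , y∈l) = ≮⇒≥ k<j⇒⊥
      where
      k<j⇒⊥ : ¬ suc k < j
      k<j⇒⊥ k<j =
        U⇒¬¬Lhigh k<j (block≤n y∈j)
          (Lx-occurrence⇒U (Lk⊆Lx (suc k) valid l p) y∈l y∈j)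
          λ (k' , k<k' , k'≤n , q) →
            Lhigh-disjoint (proj₂ (ValidK-suc valid)) k'≤n (<⇒≢ k<k') p q

    L0-vars : ∀ y j → IsY y j → (∃ λ l → Lk x ix 0 l × y inL l) → j < ix
    L0-vars y j y∈j (l , (l∈Lx , ¬high) , y∈l) =
      ≰⇒> λ ix≤j → U⇒¬¬Lhigh ix≤j (block≤n y∈j) (Lx-occurrence⇒U l∈Lx y∈l y∈j) ¬high

lemma11 : (φ : Sentence) → let open Notions φ in
    StandardForm → GAF →
    ∀ x ix → IsX x ix →
      (∀ k → ValidK x ix k → ∀ l → Lk x ix k l → Lx x ix l)
      × (∀ k ℓ → ValidK x ix k → ValidK x ix ℓ → k ≢ ℓ →
           ∀ l → Lk x ix k l → Lk x ix ℓ l → ⊥)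
      × (∀ k → ValidK x ix k → 0 < k →
           ∀ y j → IsY y j → (∃ λ l → Lk x ix k l × y inL l) → j ≤ k)
      × (∀ y j → IsY y j → (∃ λ l → Lk x ix 0 l × y inL l) → j < ix)
lemma11 φ sf _ x ix _ = Lk⊆Lx , Lk-disjoint , Lk-vars block≤n , L0-vars block≤n
  where
  open Notions φ
  open Layers φ x ix

  block≤n : ∀ {y j} → IsY y j → j ≤ n
  block≤n y∈j = proj₂ (StandardForm.blockRange sf y∈j)
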